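{- Let $\Lambda_0,\Lambda_1,\Lambda_2$ be subgroups of $\mathbb{Z}^2$ of rank two, each different from $\mathbb{Z}^2$, such that $\Lambda_0\cup\Lambda_1\cup\Lambda_2=\mathbb{Z}^2$. Then, up to permutation of the indices, $$\Lambda_0=\{(u,v)\in\mathbb{Z}^2:u\equiv0\bmod2\},\quad\Lambda_1=\{(u,v)\in\mathbb{Z}^2:v\equiv0\bmod2\},\quad\Lambda_2=\{(u,v)\in\mathbb{Z}^2:u+v\equiv0\bmod2\}.$$ -}

module Defs where

open import Data.Integer using (ℤ; +_; _+_; _*_; -_; _-_)
open import Data.Integer.Divisibility using (_∣_)
open import Data.Product using (_×_; _,_; ∃; Σ)
open import Relation.Binary.PropositionalEquality using (_≡_; _≢_)
open import Relation.Nullary using (¬_)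
open import Level using (0ℓ)
open import Relation.Unary using (Pred; _∈_; _∉_)

ℤ² : Set
ℤ² = ℤ × ℤ

record IsSubgroup (Λ : Pred ℤ² 0ℓ) : Set where
  field
    zero∈ : (+ 0 , + 0) ∈ Λ
    +-closed : ∀ {a b c d} → (a , b) ∈ Λ → (c , d) ∈ Λ → (a + c , b + d) ∈ Λ
    neg-closed : ∀ {a b} → (a , b) ∈ Λ → (- a , - b) ∈ Λ

HasRankTwo : Pred ℤ² 0ℓ → Set
HasRankTwo Λ = ∃ λ (a : ℤ) → ∃ λ (b : ℤ) → ∃ λ (c : ℤ) → ∃ λ (d : ℤ) →
  (a , b) ∈ Λ × (c , d) ∈ Λ × (a * d - b * c ≢ + 0)

IsProper : Pred ℤ² 0ℓ → Set
IsProper Λ = ∃ λ (p : ℤ²) → p ∉ Λ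

_≐_ : Pred ℤ² 0ℓ → Pred ℤ² 0ℓ → Set
Λ ≐ M = ∀ p → (p ∈ Λ → p ∈ M) × (p ∈ M → p ∈ Λ)

L₀ L₁ L₂ : Pred ℤ² 0ℓ
L₀ (u , v) = + 2 ∣ u
L₁ (u , v) = + 2 ∣ v
L₂ (u , v) = + 2 ∣ (u + v)

-- A proper subgroup of ℤ² contains no two vectors of determinant 1, since these generate ℤ².
-- Hence (0,1), (1,0), (1,1) lie in three different subgroups, say Λ₀, Λ₁, Λ₂, and the same
-- test forces (2,1) into Λ₀, (1,2) into Λ₁ and (1,-1) into Λ₂. So each Λᵢ contains the
-- index-two lattice Lᵢ, and a proper subgroup containing a subgroup of index two equals it.
module Submission where

open import Defs
open import Data.Empty using (⊥-elim)
open import Data.Fin using (Fin; zero; suc)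
open import Data.Fin.Permutation using (Permutation′; _⟨$⟩ʳ_; _⟨$⟩ˡ_; inverseʳ; transpose; _∘ₚ_) renaming (id to idₚ)
open import Data.Integer using (ℤ; +_; +[1+_]; -[1+_]; _+_; _*_; -_; _-_; _%ℕ_; _/ℕ_)
open import Data.Integer.DivMod using (a≡a%ℕn+[a/ℕn]*n; n%ℕd<d)
open import Data.Integer.Divisibility using (_∣_)
open import Data.Integer.Divisibility.Signed using (divides; ∣ᵤ⇒∣; ∣⇒∣ᵤ)
open import Data.Integer.Properties using (suc-*; neg-distribˡ-*; +-identityˡ)
open import Data.Integer.Tactic.RingSolver using (solve)
open import Data.List using (_∷_; [])
open import Data.Nat as ℕ using (s≤s)
open import Data.Product using (_×_; ∃; _,_)
open import Data.Sum using (_⊎_; inj₁; inj₂; [_,_]′; map₂)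
open import Function using (_∘_; id)
open import Level using (0ℓ)
open import Relation.Binary.PropositionalEquality using (_≡_; _≢_; refl; sym; trans; cong; subst; module ≡-Reasoning)
open import Relation.Unary using (Pred; _∈_; _∉_; _⊆_)

e₁ e₂ : ℤ²
e₁ = + 1 , + 0
e₂ = + 0 , + 1

infixl 6 _+²_

_+²_ : ℤ² → ℤ² → ℤ²
(a , b) +² (c , d) = a + c , b + d

det : ℤ² → ℤ² → ℤ
det (a , b) (c , d) = a * d - b * c

module Subgroup {H : Pred ℤ² 0ℓ} (isSubgroup : IsSubgroup H) where
  open IsSubgroup isSubgroup public

  ∈-cong : ∀ {a b c d} → (a , b) ∈ H → a ≡ c → b ≡ d → (c , d) ∈ H
  ∈-cong h refl refl = h

  +*-closed : ∀ n {a b} → (a , b) ∈ H → (+ n * a , + n * b) ∈ H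
  +*-closed ℕ.zero    h = zero∈
  +*-closed (ℕ.suc n) {a} {b} h =
    ∈-cong (+-closed h (+*-closed n h)) (sym (suc-* (+ n) a)) (sym (suc-* (+ n) b))

  *-closed : ∀ k {a b} → (a , b) ∈ H → (k * a , k * b) ∈ H
  *-closed (+ n)      h = +*-closed n h
  *-closed -[1+ n ] {a} {b} h =
    ∈-cong (neg-closed (+*-closed (ℕ.suc n) h))
      (neg-distribˡ-* +[1+ n ] a) (neg-distribˡ-* +[1+ n ] b)

  lincomb-closed : ∀ k l {a b c d} → (a , b) ∈ H → (c , d) ∈ H →
                   (k * a + l * c , k * b + l * d) ∈ H
  lincomb-closed k l g h = +-closed (*-closed k g) (*-closed l h)

  ∈-cancelˡ : ∀ {p q} → p +² q ∈ H → p ∈ H → q ∈ H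
  ∈-cancelˡ {a , b} {c , d} pq p =
    ∈-cong {c = c} {d = d} (+-closed (neg-closed p) pq) (solve (a ∷ c ∷ [])) (solve (b ∷ d ∷ []))

  ∈-cancelʳ : ∀ {p q} → p +² q ∈ H → q ∈ H → p ∈ H
  ∈-cancelʳ {a , b} {c , d} pq q =
    ∈-cong {c = a} {d = b} (+-closed pq (neg-closed q)) (solve (a ∷ c ∷ [])) (solve (b ∷ d ∷ []))

-- Cramer's rule: when det a b ≡ 1, any (u , v) is the combination of a and b below.
proper⇒det≢1 : ∀ {H a b} → IsSubgroup H → IsProper H → a ∈ H → b ∈ H → det a b ≢ + 1
proper⇒det≢1 {H} {a₁ , a₂} {b₁ , b₂} isSubgroup ((u , v) , p∉H) a∈H b∈H det≡1 =
  p∉H (∈-cong (lincomb-closed (u * b₂ - v * b₁) (v * a₁ - u * a₂) a∈H b∈H)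
               (trans first (scaled u)) (trans second (scaled v)))
  where
  open Subgroup isSubgroup
  first : (u * b₂ - v * b₁) * a₁ + (v * a₁ - u * a₂) * b₁ ≡ u * (a₁ * b₂ - a₂ * b₁)
  first = solve (u ∷ v ∷ a₁ ∷ a₂ ∷ b₁ ∷ b₂ ∷ [])
  second : (u * b₂ - v * b₁) * a₂ + (v * a₁ - u * a₂) * b₂ ≡ v * (a₁ * b₂ - a₂ * b₁)
  second = solve (u ∷ v ∷ a₁ ∷ a₂ ∷ b₁ ∷ b₂ ∷ [])
  scaled : ∀ x → x * (a₁ * b₂ - a₂ * b₁) ≡ x
  scaled x rewrite det≡1 = solve (x ∷ [])

index-two-maximal : ∀ {H L} → IsSubgroup H → IsProper H → L ⊆ H →
                    ∀ x → (∀ p → p ∈ L ⊎ p +² x ∈ L) → H ≐ L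
index-two-maximal {H} {L} isSubgroup (q , q∉H) L⊆H x cosets p = H⊆L p , L⊆H
  where
  open Subgroup isSubgroup
  H-total : x ∈ H → ∀ p → p ∈ H
  H-total x∈H p = [ L⊆H , (λ p+x∈L → ∈-cancelʳ (L⊆H p+x∈L) x∈H) ]′ (cosets p)
  H⊆L : ∀ p → p ∈ H → p ∈ L
  H⊆L p p∈H = [ id , (λ p+x∈L → ⊥-elim (q∉H (H-total (∈-cancelˡ (L⊆H p+x∈L) p∈H) q))) ]′ (cosets p)

even-or-odd : ∀ u → + 2 ∣ u ⊎ + 2 ∣ u + + 1
even-or-odd u with u %ℕ 2 | a≡a%ℕn+[a/ℕn]*n u 2 | n%ℕd<d u 2
... | 0           | u≡2q   | _ = inj₁ (∣⇒∣ᵤ (divides (u /ℕ 2) (trans u≡2q (+-identityˡ _))))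
... | 1           | u≡2q+1 | _ = inj₂ (∣⇒∣ᵤ (divides (u /ℕ 2 + + 1) (trans (cong (_+ + 1) u≡2q+1) (odd+1 (u /ℕ 2)))))
  where
  odd+1 : ∀ q → + 1 + q * + 2 + + 1 ≡ (q + + 1) * + 2
  odd+1 q = solve (q ∷ [])
... | ℕ.suc (ℕ.suc _) | _ | s≤s (s≤s ())

L₀-cosets : ∀ p → p ∈ L₀ ⊎ p +² e₁ ∈ L₀
L₀-cosets (u , v) = even-or-odd u

L₁-cosets : ∀ p → p ∈ L₁ ⊎ p +² e₂ ∈ L₁
L₁-cosets (u , v) = even-or-odd v

L₂-cosets : ∀ p → p ∈ L₂ ⊎ p +² e₁ ∈ L₂
L₂-cosets (u , v) = map₂ (subst (+ 2 ∣_) shift) (even-or-odd (u + v))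
  where
  shift : u + v + + 1 ≡ (u + + 1) + (v + + 0)
  shift = solve (u ∷ v ∷ [])

module _ {H : Pred ℤ² 0ℓ} (isSubgroup : IsSubgroup H) where
  open Subgroup isSubgroup

  L₀⊆ : (+ 2 , + 0) ∈ H → e₂ ∈ H → L₀ ⊆ H
  L₀⊆ g h {u , v} 2∣u with ∣ᵤ⇒∣ {+ 2} {u} 2∣u
  ... | divides q refl =
    ∈-cong {c = q * + 2} {d = v} (lincomb-closed q v g h) (solve (q ∷ v ∷ [])) (solve (q ∷ v ∷ []))

  L₁⊆ : e₁ ∈ H → (+ 0 , + 2) ∈ H → L₁ ⊆ H
  L₁⊆ g h {u , v} 2∣v with ∣ᵤ⇒∣ {+ 2} {v} 2∣v
  ... | divides q refl =
    ∈-cong {c = u} {d = q * + 2} (lincomb-closed u q g h) (solve (u ∷ q ∷ [])) (solve (u ∷ q ∷ []))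

  L₂⊆ : (+ 1 , + 1) ∈ H → (+ 2 , + 0) ∈ H → L₂ ⊆ H
  L₂⊆ g h {u , v} 2∣u+v with ∣ᵤ⇒∣ {+ 2} {u + v} 2∣u+v
  ... | divides q u+v≡2q =
    ∈-cong {c = u} {d = v} (lincomb-closed v (q - v) g h) first (solve (v ∷ q ∷ []))
    where
    open ≡-Reasoning
    first : v * + 1 + (q - v) * + 2 ≡ u
    first = begin
      v * + 1 + (q - v) * + 2 ≡⟨ solve (v ∷ q ∷ []) ⟩
      q * + 2 - v             ≡⟨ cong (_- v) u+v≡2q ⟨
      u + v - v               ≡⟨ solve (u ∷ v ∷ []) ⟩
      u                       ∎

three-subgroups-covering : ∀ {A B C} → IsSubgroup A → IsSubgroup B → IsSubgroup C →
  IsProper A → IsProper B → IsProper C → (∀ p → p ∈ A ⊎ p ∈ B ⊎ p ∈ C) →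
  e₂ ∈ A → e₁ ∈ B → (A ≐ L₀) × (B ≐ L₁) × (C ≐ L₂)
three-subgroups-covering {A} {B} {C} SA SB SC PA PB PC cover e₂∈A e₁∈B =
    index-two-maximal SA PA (L₀⊆ SA ⟨2,0⟩∈A e₂∈A) e₁ L₀-cosets
  , index-two-maximal SB PB (L₁⊆ SB e₁∈B ⟨0,2⟩∈B) e₂ L₁-cosets
  , index-two-maximal SC PC (L₂⊆ SC ⟨1,1⟩∈C ⟨2,0⟩∈C) e₁ L₂-cosets
  where
  module A = IsSubgroup SA
  module B = IsSubgroup SB
  module C = IsSubgroup SC

  inA : ∀ {p} → p ∉ B → p ∉ C → p ∈ A
  inA ∉B ∉C = [ id , [ ⊥-elim ∘ ∉B , ⊥-elim ∘ ∉C ]′ ]′ (cover _)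
  inB : ∀ {p} → p ∉ A → p ∉ C → p ∈ B
  inB ∉A ∉C = [ ⊥-elim ∘ ∉A , [ id , ⊥-elim ∘ ∉C ]′ ]′ (cover _)
  inC : ∀ {p} → p ∉ A → p ∉ B → p ∈ C
  inC ∉A ∉B = [ ⊥-elim ∘ ∉A , [ ⊥-elim ∘ ∉B , id ]′ ]′ (cover _)

  ⟨1,1⟩∈C : (+ 1 , + 1) ∈ C
  ⟨1,1⟩∈C = inC (λ h → proper⇒det≢1 SA PA h e₂∈A refl) (λ h → proper⇒det≢1 SB PB e₁∈B h refl)
  ⟨2,1⟩∈A : (+ 2 , + 1) ∈ A
  ⟨2,1⟩∈A = inA (λ h → proper⇒det≢1 SB PB e₁∈B h refl) (λ h → proper⇒det≢1 SC PC h ⟨1,1⟩∈C refl)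
  ⟨1,2⟩∈B : (+ 1 , + 2) ∈ B
  ⟨1,2⟩∈B = inB (λ h → proper⇒det≢1 SA PA h e₂∈A refl) (λ h → proper⇒det≢1 SC PC ⟨1,1⟩∈C h refl)
  ⟨1,-1⟩∈C : (+ 1 , - + 1) ∈ C
  ⟨1,-1⟩∈C = inC (λ h → proper⇒det≢1 SA PA h e₂∈A refl) (λ h → proper⇒det≢1 SB PB h e₁∈B refl)

  ⟨2,0⟩∈A : (+ 2 , + 0) ∈ A
  ⟨2,0⟩∈A = A.+-closed ⟨2,1⟩∈A (A.neg-closed e₂∈A)
  ⟨0,2⟩∈B : (+ 0 , + 2) ∈ B
  ⟨0,2⟩∈B = B.+-closed ⟨1,2⟩∈B (B.neg-closed e₁∈B)
  ⟨2,0⟩∈C : (+ 2 , + 0) ∈ C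
  ⟨2,0⟩∈C = C.+-closed ⟨1,1⟩∈C ⟨1,-1⟩∈C

Any₃ : (Fin 3 → Set) → Set
Any₃ P = P zero ⊎ P (suc zero) ⊎ P (suc (suc zero))

Any₃⇒∃ : ∀ P → Any₃ P → ∃ P
Any₃⇒∃ P (inj₁ p)        = zero , p
Any₃⇒∃ P (inj₂ (inj₁ p)) = suc zero , p
Any₃⇒∃ P (inj₂ (inj₂ p)) = suc (suc zero) , p

∃⇒Any₃ : ∀ P → ∃ P → Any₃ P
∃⇒Any₃ P (zero , p)           = inj₁ p
∃⇒Any₃ P (suc zero , p)       = inj₂ (inj₁ p)
∃⇒Any₃ P (suc (suc zero) , p) = inj₂ (inj₂ p)

Any₃-permute : ∀ P (σ : Permutation′ 3) → Any₃ P → Any₃ (P ∘ (σ ⟨$⟩ʳ_))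
Any₃-permute P σ some with Any₃⇒∃ P some
... | i , pᵢ = ∃⇒Any₃ (P ∘ (σ ⟨$⟩ʳ_)) (σ ⟨$⟩ˡ i , subst P (sym (inverseʳ σ)) pᵢ)

permutation-sending : (i j : Fin 3) → i ≢ j →
                      ∃ λ (σ : Permutation′ 3) → σ ⟨$⟩ʳ zero ≡ i × σ ⟨$⟩ʳ suc zero ≡ j
permutation-sending zero             (suc zero)       _ = idₚ , refl , refl
permutation-sending zero             (suc (suc zero)) _ = transpose (suc zero) (suc (suc zero)) , refl , refl
permutation-sending (suc zero)       zero             _ = transpose zero (suc zero) , refl , refl
permutation-sending (suc zero)       (suc (suc zero)) _ =
  transpose (suc zero) (suc (suc zero)) ∘ₚ transpose zero (suc zero) , refl , refl
permutation-sending (suc (suc zero)) zero             _ =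
  transpose zero (suc zero) ∘ₚ transpose (suc zero) (suc (suc zero)) , refl , refl
permutation-sending (suc (suc zero)) (suc zero)       _ = transpose zero (suc (suc zero)) , refl , refl
permutation-sending zero             zero             i≢i = ⊥-elim (i≢i refl)
permutation-sending (suc zero)       (suc zero)       i≢i = ⊥-elim (i≢i refl)
permutation-sending (suc (suc zero)) (suc (suc zero)) i≢i = ⊥-elim (i≢i refl)

lemma6p7 : (Λ : Fin 3 → Pred ℤ² 0ℓ) →
    (∀ i → IsSubgroup (Λ i)) →
    (∀ i → HasRankTwo (Λ i)) →
    (∀ i → IsProper (Λ i)) →
    (∀ p → p ∈ Λ zero ⊎ p ∈ Λ (suc zero) ⊎ p ∈ Λ (suc (suc zero))) →
    ∃ λ (σ : Permutation′ 3) →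
      (Λ (σ ⟨$⟩ʳ zero) ≐ L₀) × (Λ (σ ⟨$⟩ʳ suc zero) ≐ L₁) × (Λ (σ ⟨$⟩ʳ suc (suc zero)) ≐ L₂)
lemma6p7 Λ isSubgroup _ isProper cover
  with Any₃⇒∃ (λ i → e₂ ∈ Λ i) (cover e₂) | Any₃⇒∃ (λ i → e₁ ∈ Λ i) (cover e₁)
... | i , e₂∈Λi | j , e₁∈Λj
  with permutation-sending i j (λ { refl → proper⇒det≢1 (isSubgroup i) (isProper i) e₁∈Λj e₂∈Λi refl })
... | σ , refl , refl =
  σ , three-subgroups-covering (isSubgroup _) (isSubgroup _) (isSubgroup _)
                               (isProper _) (isProper _) (isProper _)
                               (λ p → Any₃-permute (λ i → p ∈ Λ i) σ (cover p)) e₂∈Λi e₁∈Λj
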